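{- Let $n,s,k$ be integers with $k\geq 2$, $s\geq 3$ and $n\geq sk+1$. Then: (1) if $s(k+1)-1\leq n$, the graph $G(n,k,s)$ is isomorphic to $C_n^{s-1}$; (2) if $sk+1\leq n\leq s(k+1)-2$, then, writing $r=n-sk$, for $i,j\in[n]$ we have that $i$ and $j$ are adjacent in $G(n,k,s)$ if and only if $i\neq j$ and $|j-i|\notin\bigcup_{d=1}^{k-1}\{ds,ds+1,\dots,ds+r\}$ (here $|j-i|$ is the usual absolute value of the difference of the integers $i,j\in\{1,\dots,n\}$).
   Context: Let $[n]=\{1,\dots,n\}$. A subset $S\subseteq[n]$ is $s$-stable if for all distinct $i,j\in S$ we have $s\leq |i-j|\leq n-s$. $[n]^k_s$ denotes the family of $s$-stable $k$-element subsets of $[n]$. The graph $G(n,k,s)$ has vertex set $[n]$, and two distinct vertices $i,j$ are adjacent iff there is no $S\in[n]^k_s$ with $\{i,j\}\subseteq S$. $C_n$ is the cycle with vertex set $[n]$ and edges $\{i,i+1\}$ (indices modulo $n$, with $n$ playing the role of $0$), and $C_n^{q}$ is its $q$-th power: same vertex set, two distinct vertices adjacent iff their distance in $C_n$ is at most $q$. -}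

module Defs where

open import Data.Nat using (ℕ; _≤_; _⊓_; _∸_; ∣_-_∣)
open import Data.List using (List; length)
open import Data.List.Membership.Propositional using (_∈_)
open import Data.List.Relation.Unary.All using (All)
open import Data.List.Relation.Unary.Unique.Propositional using (Unique)
open import Data.Product using (Σ; _×_)
open import Relation.Binary.PropositionalEquality using (_≡_; _≢_)
open import Relation.Nullary using (¬_)
open import Function.Bundles using (_⇔_)

InN : ℕ → ℕ → Set
InN n i = 1 ≤ i × i ≤ n

Stable : ℕ → ℕ → List ℕ → Set
Stable n s S = ∀ {i j} → i ∈ S → j ∈ S → i ≢ j →
  (s ≤ ∣ i - j ∣) × (∣ i - j ∣ ≤ n ∸ s)

-- S ∈ [n]^k_s : S is a k-element s-stable subset of [n],
-- represented as a duplicate-free list of length k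
StableSet : ℕ → ℕ → ℕ → List ℕ → Set
StableSet n k s S = Unique S × length S ≡ k × All (InN n) S × Stable n s S

AdjG : ℕ → ℕ → ℕ → ℕ → ℕ → Set
AdjG n k s i j = i ≢ j × ¬ (Σ (List ℕ) λ S → StableSet n k s S × i ∈ S × j ∈ S)

cycDist : ℕ → ℕ → ℕ → ℕ
cycDist n i j = ∣ i - j ∣ ⊓ (n ∸ ∣ i - j ∣)

AdjCPow : ℕ → ℕ → ℕ → ℕ → Set
AdjCPow n q i j = i ≢ j × cycDist n i j ≤ q

Iso : ℕ → (ℕ → ℕ → Set) → (ℕ → ℕ → Set) → Set
Iso n A B = Σ (ℕ → ℕ) λ f → Σ (ℕ → ℕ) λ g →
  (∀ i → InN n i → InN n (f i)) ×
  (∀ i → InN n i → InN n (g i)) ×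
  (∀ i → InN n i → g (f i) ≡ i) ×
  (∀ i → InN n i → f (g i) ≡ i) ×
  (∀ i j → InN n i → InN n j → A i j ⇔ B (f i) (f j))

InForbidden : ℕ → ℕ → ℕ → ℕ → Set
InForbidden k s r m = Σ ℕ λ d → 1 ≤ d × d ≤ k ∸ 1 × d * s ≤ m × m ≤ d * s + r
  where open Data.Nat using (_*_; _+_)

-- Cut the cycle open at i and read the points of a k-element s-stable set containing
-- i < j = i + m as numbers in the window [i, i + n).  Those below j and those from j on
-- are pairwise s apart, so a packing bound puts a·s ≤ m and b·s ≤ n − m on their numbers
-- a, b ≥ 1 with a + b = k; conversely two progressions of step s starting at i and at j,
-- read back modulo n, form such a set.  Adjacency in G(n,k,s) is therefore the failure of
-- this arithmetic condition on m = |i − j|.  For n ≥ s(k+1) − 1 the condition says exactly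
-- that m and n − m are both at least s (take a = min(⌊m/s⌋, k − 1)); writing n = sk + r
-- it says ds ≤ m ≤ ds + r for d = a.
module Submission where

open import Data.Nat
  using (ℕ; suc; _≤_; _<_; _+_; _*_; _∸_; _⊓_; ∣_-_∣; z≤n; s≤s; NonZero; pred; >-nonZero; >-nonZero⁻¹)
open import Data.Nat.Properties
open import Data.Nat.DivMod using (_/_; _%_; m≡m%n+[m/n]*n; m%n<n; m/n*n≤m; m≥n⇒m/n>0)
open import Data.Nat.Tactic.RingSolver using (solve-∀)
open import Data.Bool using (true; false)
open import Data.Empty using (⊥-elim)
open import Data.List using (List; []; _∷_; length; map; filter; applyUpTo; _++_)
open import Data.List.Properties using (length-map; length-++; length-applyUpTo)
open import Data.List.Membership.Propositional using (_∈_)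
open import Data.List.Membership.Propositional.Properties
  using (∈-map⁺; ∈-++⁺ˡ; ∈-++⁺ʳ; ∈-filter⁺; ∈-filter⁻; ∈-length)
open import Data.List.Relation.Unary.Any using (here; there)
open import Data.List.Relation.Unary.All as All using (All; []; _∷_)
import Data.List.Relation.Unary.All.Properties as All
open import Data.List.Relation.Unary.AllPairs as AllPairs using (AllPairs; []; _∷_)
import Data.List.Relation.Unary.AllPairs.Properties as AllPairs
open import Data.List.Relation.Unary.Linked.Properties using (Linked⇒AllPairs)
open import Data.List.Relation.Unary.Unique.Propositional using (Unique)
open import Data.List.Relation.Binary.Permutation.Propositional using (↭-sym; ↭⇒↭ₛ)
open import Data.List.Relation.Binary.Permutation.Propositional.Properties using (All-resp-↭; ↭-length)
import Data.List.Relation.Binary.Permutation.Setoid.Properties as Perm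
open import Data.List.Sort ≤-decTotalOrder using (sort; sort-↭; sort-↗)
open import Data.Product using (Σ; _×_; _,_; proj₁; proj₂)
open import Data.Product.Function.NonDependent.Propositional using (_×-⇔_)
open import Data.Sum using (_⊎_; inj₁; inj₂; swap)
open import Function using (id; _∘_)
open import Function.Bundles using (_⇔_; mk⇔; Equivalence)
open import Function.Construct.Composition using (_⇔-∘_)
open import Function.Construct.Identity using (⇔-id)
open import Function.Related.TypeIsomorphisms using (¬-cong-⇔)
open import Relation.Binary.Definitions using (Symmetric; tri<; tri≈; tri>)
open import Relation.Binary.PropositionalEquality
open import Relation.Nullary using (¬_; yes; no; does; contradiction)
open import Relation.Nullary.Decidable using (¬?)
open import Relation.Unary using (Decidable)
open import Defs

module _ {A : Set} where

  Unique⇒AllPairs : ∀ {R : A → A → Set} {xs} → Unique xs →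
    (∀ {x y} → x ∈ xs → y ∈ xs → x ≢ y → R x y) → AllPairs R xs
  Unique⇒AllPairs [] r = []
  Unique⇒AllPairs (x∉xs ∷ u) r =
    All.tabulate (λ y∈xs → r (here refl) (there y∈xs) (All.lookup x∉xs y∈xs)) ∷
    Unique⇒AllPairs u (λ x∈ y∈ → r (there x∈) (there y∈))

  AllPairs-lookup : ∀ {R : A → A → Set} {xs} → Symmetric R → AllPairs R xs →
    ∀ {x y} → x ∈ xs → y ∈ xs → x ≢ y → R x y
  AllPairs-lookup sym (_ ∷ _) (here refl) (here refl) x≢y = ⊥-elim (x≢y refl)
  AllPairs-lookup sym (rx ∷ _) (here refl) (there y∈) _ = All.lookup rx y∈
  AllPairs-lookup sym (rx ∷ _) (there x∈) (here refl) _ = sym (All.lookup rx x∈)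
  AllPairs-lookup sym (_ ∷ r) (there x∈) (there y∈) x≢y = AllPairs-lookup sym r x∈ y∈ x≢y

  All⇒AllPairs-× : ∀ {P : A → Set} {xs} → All P xs → AllPairs (λ x y → P x × P y) xs
  All⇒AllPairs-× [] = []
  All⇒AllPairs-× (px ∷ pxs) = All.map (px ,_) pxs ∷ All⇒AllPairs-× pxs

  length-filter+length-filter-∁ : ∀ {P : A → Set} (P? : Decidable P) xs →
    length (filter P? xs) + length (filter (¬? ∘ P?) xs) ≡ length xs
  length-filter+length-filter-∁ P? [] = refl
  length-filter+length-filter-∁ P? (x ∷ xs) with does (P? x)
  ... | true = cong suc (length-filter+length-filter-∁ P? xs)
  ... | false = trans (+-suc _ _) (cong suc (length-filter+length-filter-∁ P? xs))

-- Packing s-apart points into an interval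

Apart : ℕ → ℕ → ℕ → Set
Apart s x y = x + s ≤ y ⊎ y + s ≤ x

Within : ℕ → ℕ → ℕ → ℕ → Set
Within s a c y = a ≤ y × y + s ≤ c

Within-weaken : ∀ {s a a′ c c′ y} → a′ ≤ a → c ≤ c′ → Within s a c y → Within s a′ c′ y
Within-weaken a′≤a c≤c′ (a≤y , y+s≤c) = ≤-trans a′≤a a≤y , ≤-trans y+s≤c c≤c′

packing-increasing : ∀ {s a c xs} → AllPairs (λ x y → x + s ≤ y) xs →
  All (Within s a c) xs → length xs * s ≤ c ∸ a
packing-increasing [] [] = z≤n
packing-increasing {s} {a} {c} {x ∷ xs} (x+s≤xs ∷ increasing) ((a≤x , x+s≤c) ∷ within) = begin
  s + length xs * s  ≤⟨ +-monoʳ-≤ s (packing-increasing increasing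
                          (All.zipWith (λ (x+s≤y , (_ , y+s≤c)) → x+s≤y , y+s≤c) (x+s≤xs , within))) ⟩
  s + (c ∸ (x + s))            ≡⟨ m+n∸m≡n x _ ⟨
  x + (s + (c ∸ (x + s))) ∸ x  ≡⟨ cong (_∸ x) (trans (sym (+-assoc x s _)) (m+[n∸m]≡n x+s≤c)) ⟩
  c ∸ x                        ≤⟨ ∸-monoʳ-≤ c a≤x ⟩
  c ∸ a                        ∎
  where open ≤-Reasoning

packing : ∀ {s a c xs} → AllPairs (Apart s) xs → All (Within s a c) xs → length xs * s ≤ c ∸ a
packing {s} {a} {c} {xs} apart within =
  subst (λ l → l * s ≤ c ∸ a) (↭-length (sort-↭ xs))
    (packing-increasing increasing (All-resp-↭ (↭-sym (sort-↭ xs)) within))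
  where
  apart-sorted : AllPairs (Apart s) (sort xs)
  apart-sorted = Perm.AllPairs-resp-↭ (setoid ℕ) swap (resp₂ (Apart s)) (↭⇒↭ₛ (↭-sym (sort-↭ xs))) apart
  ordered-apart⇒gap : ∀ {x y} → x ≤ y × Apart s x y → x + s ≤ y
  ordered-apart⇒gap (_ , inj₁ x+s≤y) = x+s≤y
  ordered-apart⇒gap {x} {y} (x≤y , inj₂ y+s≤x)
    with refl ← n≤0⇒n≡0 (+-cancelˡ-≤ y s 0 (subst (y + s ≤_) (sym (+-identityʳ y)) (≤-trans y+s≤x x≤y)))
    = subst (_≤ y) (sym (+-identityʳ x)) x≤y
  increasing : AllPairs (λ x y → x + s ≤ y) (sort xs)
  increasing = AllPairs.zipWith ordered-apart⇒gap (Linked⇒AllPairs ≤-trans (sort-↗ xs) , apart-sorted)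

-- The cycle cut open at a point

FarOnCycle : ℕ → ℕ → ℕ → Set
FarOnCycle n s e = s ≤ e × e ≤ n ∸ s

FarOnCycle-sym : ∀ {n s x y} → FarOnCycle n s ∣ x - y ∣ → FarOnCycle n s ∣ y - x ∣
FarOnCycle-sym {n} {s} {x} {y} = subst (FarOnCycle n s) (∣-∣-comm x y)

FarOnCycle⇒≢ : ∀ {n s x y} → 1 ≤ s → FarOnCycle n s ∣ x - y ∣ → x ≢ y
FarOnCycle⇒≢ {x = x} 1≤s (s≤∣x-x∣ , _) refl =
  contradiction (subst (1 ≤_) (∣n-n∣≡0 x) (≤-trans 1≤s s≤∣x-x∣)) λ ()

FarOnCycle-∸ : ∀ {n s e} → s ≤ n → e ≤ n → FarOnCycle n s e → FarOnCycle n s (n ∸ e)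
FarOnCycle-∸ {n} {s} {e} s≤n e≤n (s≤e , e≤n∸s) =
  m+n≤o⇒m≤o∸n s (subst (_≤ n) (+-comm e s) (m≤o∸n⇒m+n≤o e s≤n e≤n∸s)) , ∸-monoʳ-≤ n s≤e

FarOnCycle⇔gaps : ∀ {n s} u d → s ≤ n → FarOnCycle n s d ⇔ (u + s ≤ u + d × u + d + s ≤ u + n)
FarOnCycle⇔gaps {n} {s} u d s≤n = mk⇔
  (λ (s≤d , d≤n∸s) → +-monoʳ-≤ u s≤d ,
     ≤-trans (≤-reflexive (+-assoc u d s)) (+-monoʳ-≤ u (m≤o∸n⇒m+n≤o d s≤n d≤n∸s)))
  (λ (u+s≤u+d , u+d+s≤u+n) → +-cancelˡ-≤ u s d u+s≤u+d ,
     m+n≤o⇒m≤o∸n d (+-cancelˡ-≤ u (d + s) n (≤-trans (≤-reflexive (sym (+-assoc u d s))) u+d+s≤u+n)))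

-- unroll n i x is the point x ∈ [n] read in the window [i, i + n) of the cycle cut open
-- at i; roll n maps the window back onto [n].
roll : ℕ → ℕ → ℕ
roll n z with z ≤? n
... | yes _ = z
... | no _ = z ∸ n

unroll : ℕ → ℕ → ℕ → ℕ
unroll n i x with i ≤? x
... | yes _ = x
... | no _ = x + n

roll-≤ : ∀ {n z} → z ≤ n → roll n z ≡ z
roll-≤ {n} {z} z≤n′ with z ≤? n
... | yes _ = refl
... | no z≰n = contradiction z≤n′ z≰n

roll-> : ∀ {n z} → n < z → roll n z ≡ z ∸ n
roll-> {n} {z} n<z with z ≤? n
... | yes z≤n′ = contradiction z≤n′ (<⇒≱ n<z)
... | no _ = refl

roll-∈ : ∀ {n i z} → 1 ≤ i → i ≤ n → i ≤ z → z < i + n → InN n (roll n z)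
roll-∈ {n} {i} {z} 1≤i i≤n i≤z z<i+n with ≤-<-connex z n
... | inj₁ z≤n′ = subst (InN n) (sym (roll-≤ z≤n′)) (≤-trans 1≤i i≤z , z≤n′)
... | inj₂ n<z = subst (InN n) (sym (roll-> n<z))
      (m<n⇒0<n∸m n<z , m≤n+o⇒m∸n≤o z n (≤-trans (<⇒≤ z<i+n) (+-monoˡ-≤ n i≤n)))

∣roll-roll+∣ : ∀ {n u} d → d ≤ n →
  ∣ roll n u - roll n (u + d) ∣ ≡ d ⊎ ∣ roll n u - roll n (u + d) ∣ ≡ n ∸ d
∣roll-roll+∣ {n} {u} d d≤n with ≤-<-connex (u + d) n
... | inj₁ u+d≤n = inj₁ (begin
  ∣ roll n u - roll n (u + d) ∣ ≡⟨ cong₂ ∣_-_∣ (roll-≤ (m+n≤o⇒m≤o u u+d≤n)) (roll-≤ u+d≤n) ⟩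
  ∣ u - u + d ∣                 ≡⟨ ∣m-m+n∣≡n u d ⟩
  d                             ∎)
  where open ≡-Reasoning
... | inj₂ n<u+d with ≤-<-connex u n
...   | inj₂ n<u = inj₁ (begin
  ∣ roll n u - roll n (u + d) ∣ ≡⟨ cong₂ ∣_-_∣ (roll-> n<u) (roll-> n<u+d) ⟩
  ∣ u ∸ n - u + d ∸ n ∣         ≡⟨ cong (∣ u ∸ n -_∣) (+-∸-comm d (<⇒≤ n<u)) ⟩
  ∣ u ∸ n - u ∸ n + d ∣         ≡⟨ ∣m-m+n∣≡n (u ∸ n) d ⟩
  d                             ∎)
  where open ≡-Reasoning
...   | inj₁ u≤n = inj₂ (begin
  ∣ roll n u - roll n (u + d) ∣ ≡⟨ cong₂ ∣_-_∣ (roll-≤ u≤n) (roll-> n<u+d) ⟩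
  ∣ u - w ∣                     ≡⟨ cong (∣_- w ∣) u≡w+[n∸d] ⟩
  ∣ w + (n ∸ d) - w ∣           ≡⟨ ∣-∣-comm (w + (n ∸ d)) w ⟩
  ∣ w - w + (n ∸ d) ∣           ≡⟨ ∣m-m+n∣≡n w (n ∸ d) ⟩
  n ∸ d                         ∎)
  where
  open ≡-Reasoning
  w = u + d ∸ n
  u≡w+[n∸d] : u ≡ w + (n ∸ d)
  u≡w+[n∸d] = +-cancelʳ-≡ d u (w + (n ∸ d)) (begin
    u + d                ≡⟨ m∸n+n≡m (<⇒≤ n<u+d) ⟨
    w + n                ≡⟨ cong (w +_) (m∸n+n≡m d≤n) ⟨
    w + (n ∸ d + d)      ≡⟨ +-assoc w (n ∸ d) d ⟨
    w + (n ∸ d) + d      ∎)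

roll-far⇔far : ∀ {n s u} d → s ≤ n → d ≤ n →
  FarOnCycle n s ∣ roll n u - roll n (u + d) ∣ ⇔ FarOnCycle n s d
roll-far⇔far {n} {s} {u} d s≤n d≤n with ∣roll-roll+∣ {u = u} d d≤n
... | inj₁ dist≡d = subst (λ e → FarOnCycle n s e ⇔ FarOnCycle n s d) (sym dist≡d) (mk⇔ id id)
... | inj₂ dist≡n∸d = subst (λ e → FarOnCycle n s e ⇔ FarOnCycle n s d) (sym dist≡n∸d)
      (mk⇔ from (FarOnCycle-∸ s≤n d≤n))
  where
  from : FarOnCycle n s (n ∸ d) → FarOnCycle n s d
  from far = subst (FarOnCycle n s) (m∸[m∸n]≡n d≤n) (FarOnCycle-∸ s≤n (m∸n≤m n d) far)

roll-far⇔gaps : ∀ {n s u v} → s ≤ n → u ≤ v → v ≤ u + n →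
  FarOnCycle n s ∣ roll n u - roll n v ∣ ⇔ (u + s ≤ v × v + s ≤ u + n)
roll-far⇔gaps {n} {u = u} s≤n u≤v v≤u+n with m≤n⇒∃[o]m+o≡n u≤v
... | d , refl = FarOnCycle⇔gaps u d s≤n ⇔-∘ roll-far⇔far {u = u} d s≤n (+-cancelˡ-≤ u d n v≤u+n)

unroll-≥ : ∀ {n i x} → i ≤ x → unroll n i x ≡ x
unroll-≥ {n} {i} {x} i≤x with i ≤? x
... | yes _ = refl
... | no i≰x = contradiction i≤x i≰x

roll-unroll : ∀ {n} i {x} → InN n x → roll n (unroll n i x) ≡ x
roll-unroll {n} i {x} (1≤x , x≤n) with i ≤? x
... | yes _ = roll-≤ x≤n
... | no _ = trans (roll-> (m<n+m n 1≤x)) (m+n∸n≡m x n)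

unroll-window : ∀ {n i x} → 1 ≤ i → i ≤ n → InN n x → i ≤ unroll n i x × unroll n i x < i + n
unroll-window {n} {i} {x} 1≤i i≤n (_ , x≤n) with i ≤? x
... | yes i≤x = i≤x , ≤-<-trans x≤n (m<n+m n 1≤i)
... | no i≰x = ≤-trans i≤n (m≤n+m n x) , +-monoˡ-< n (≰⇒> i≰x)

Cooccur : ℕ → ℕ → ℕ → ℕ → ℕ → Set
Cooccur n k s i j = Σ (List ℕ) λ S → StableSet n k s S × i ∈ S × j ∈ S

Cooccur-sym : ∀ {n k s i j} → Cooccur n k s i j → Cooccur n k s j i
Cooccur-sym (S , stable , i∈S , j∈S) = S , stable , j∈S , i∈S

-- The k points of a stable set through i and i + m, split into the a points on the arc
-- from i to i + m and the b points on the arc from i + m back round to i.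
Splits : ℕ → ℕ → ℕ → ℕ → Set
Splits n k s m = Σ ℕ λ a → Σ ℕ λ b → 1 ≤ a × 1 ≤ b × a + b ≡ k × a * s ≤ m × b * s + m ≤ n

progression : ℕ → ℕ → ℕ → List ℕ
progression s x a = applyUpTo (λ t → t * s + x) a

progression-step : ∀ t s x → t * s + x + s ≡ suc t * s + x
progression-step = solve-∀

progression-increasing : ∀ s x a → AllPairs (λ z w → z + s ≤ w) (progression s x a)
progression-increasing s x a = AllPairs.applyUpTo⁺₁ _ a λ {t} t<t′ _ →
  ≤-trans (≤-reflexive (progression-step t s x)) (+-monoˡ-≤ x (*-monoˡ-≤ s t<t′))

progression-within : ∀ s x a → All (Within s x (a * s + x)) (progression s x a)
progression-within s x a = All.applyUpTo⁺₁ _ a λ {t} t<a →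
  m≤n+m x (t * s) , ≤-trans (≤-reflexive (progression-step t s x)) (+-monoˡ-≤ x (*-monoˡ-≤ s t<a))

head∈progression : ∀ {s x a} → 1 ≤ a → x ∈ progression s x a
head∈progression {a = suc _} _ = here refl

rolled-stable : ∀ {n s i L} → 1 ≤ s → s ≤ n → 1 ≤ i → i ≤ n →
  All (Within s i (i + n)) L → AllPairs (λ z w → z + s ≤ w) L →
  Unique (map (roll n) L) × All (InN n) (map (roll n) L) × Stable n s (map (roll n) L)
rolled-stable {n} {s} {i} {L} 1≤s s≤n 1≤i i≤n window increasing =
  AllPairs.map (FarOnCycle⇒≢ 1≤s) far ,
  All.map⁺ (All.map (λ (i≤z , z+s≤i+n) → roll-∈ 1≤i i≤n i≤z (<-≤-trans (m<m+n _ 1≤s) z+s≤i+n)) window) ,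
  AllPairs-lookup (λ {x} {y} → FarOnCycle-sym {x = x} {y}) far
  where
  far-apart : ∀ {z w} → Within s i (i + n) z × Within s i (i + n) w → z + s ≤ w →
    FarOnCycle n s ∣ roll n z - roll n w ∣
  far-apart ((i≤z , _) , (_ , w+s≤i+n)) z+s≤w =
    Equivalence.from (roll-far⇔gaps s≤n (m+n≤o⇒m≤o _ z+s≤w) (m+n≤o⇒m≤o _ w+s≤z+n)) (z+s≤w , w+s≤z+n)
    where w+s≤z+n = ≤-trans w+s≤i+n (+-monoˡ-≤ n i≤z)
  far : AllPairs (λ x y → FarOnCycle n s ∣ x - y ∣) (map (roll n) L)
  far = AllPairs.map⁺ (AllPairs.zipWith (λ (within , z+s≤w) → far-apart within z+s≤w)
                                         (All⇒AllPairs-× window , increasing))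

unrolled-apart : ∀ {n s i S} → s ≤ n → 1 ≤ i → i ≤ n → i ∈ S →
  Unique S → All (InN n) S → Stable n s S →
  AllPairs (Apart s) (map (unroll n i) S) × All (Within s i (i + n)) (map (unroll n i) S)
unrolled-apart {n} {s} {i} {S} s≤n 1≤i i≤n i∈S unique in-range stable =
  AllPairs.map⁺ (Unique⇒AllPairs unique apart) , All.map⁺ (All.tabulate within)
  where
  u = unroll n i
  window : ∀ {x} → x ∈ S → i ≤ u x × u x < i + n
  window x∈S = unroll-window 1≤i i≤n (All.lookup in-range x∈S)
  gaps : ∀ {x y} → x ∈ S → y ∈ S → x ≢ y → u x ≤ u y → u x + s ≤ u y × u y + s ≤ u x + n
  gaps x∈S y∈S x≢y ux≤uy = Equivalence.to (roll-far⇔gaps s≤n ux≤uy uy≤ux+n)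
    (subst₂ (λ x′ y′ → FarOnCycle n s ∣ x′ - y′ ∣) (rolled x∈S) (rolled y∈S) (stable x∈S y∈S x≢y))
    where
    uy≤ux+n = <⇒≤ (<-≤-trans (proj₂ (window y∈S)) (+-monoˡ-≤ n (proj₁ (window x∈S))))
    rolled : ∀ {z} → z ∈ S → z ≡ roll n (u z)
    rolled z∈S = sym (roll-unroll i (All.lookup in-range z∈S))
  apart : ∀ {x y} → x ∈ S → y ∈ S → x ≢ y → Apart s (u x) (u y)
  apart {x} {y} x∈S y∈S x≢y with ≤-total (u x) (u y)
  ... | inj₁ ux≤uy = inj₁ (proj₁ (gaps x∈S y∈S x≢y ux≤uy))
  ... | inj₂ uy≤ux = inj₂ (proj₁ (gaps y∈S x∈S (x≢y ∘ sym) uy≤ux))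
  ui≡i : u i ≡ i
  ui≡i = unroll-≥ ≤-refl
  within : ∀ {x} → x ∈ S → Within s i (i + n) (u x)
  within {x} x∈S with x ≟ i
  ... | yes refl = subst (Within s i (i + n)) (sym ui≡i) (≤-refl , +-monoʳ-≤ i s≤n)
  ... | no x≢i = proj₁ (window x∈S) ,
        subst (λ v → u x + s ≤ v + n) ui≡i
          (proj₂ (gaps i∈S x∈S (x≢i ∘ sym) (subst (_≤ u x) (sym ui≡i) (proj₁ (window x∈S)))))

splits⇒cooccur : ∀ {n k s i m} → 1 ≤ s → s ≤ n → 1 ≤ i → i + m ≤ n →
  Splits n k s m → Cooccur n k s i (i + m)
splits⇒cooccur {n} {k} {s} {i} {m} 1≤s s≤n 1≤i i+m≤n (a , b , 1≤a , 1≤b , a+b≡k , as≤m , bs+m≤n) =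
  map (roll n) L ,
  (unique , length-rolled , in-range , stable) ,
  rolled∈ i≤n (∈-++⁺ˡ (head∈progression 1≤a)) ,
  rolled∈ i+m≤n (∈-++⁺ʳ (progression s i a) (head∈progression 1≤b))
  where
  j = i + m
  L = progression s i a ++ progression s j b
  m≤n = m+n≤o⇒n≤o i i+m≤n
  i≤n = m+n≤o⇒m≤o i i+m≤n
  as+i≤j : a * s + i ≤ j
  as+i≤j = ≤-trans (+-monoˡ-≤ i as≤m) (≤-reflexive (+-comm m i))
  bs+j≤i+n : b * s + j ≤ i + n
  bs+j≤i+n = begin
    b * s + (i + m)  ≡⟨ +-comm (b * s) (i + m) ⟩
    i + m + b * s    ≡⟨ +-assoc i m (b * s) ⟩
    i + (m + b * s)  ≤⟨ +-monoʳ-≤ i (subst (_≤ n) (+-comm (b * s) m) bs+m≤n) ⟩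
    i + n            ∎
    where open ≤-Reasoning
  window : All (Within s i (i + n)) L
  window = All.++⁺
    (All.map (Within-weaken ≤-refl (≤-trans as+i≤j (+-monoʳ-≤ i m≤n))) (progression-within s i a))
    (All.map (Within-weaken (m≤m+n i m) bs+j≤i+n) (progression-within s j b))
  increasing : AllPairs (λ z w → z + s ≤ w) L
  increasing = AllPairs.++⁺ (progression-increasing s i a) (progression-increasing s j b)
    (All.map (λ (_ , z+s≤as+i) → All.map (λ (j≤w , _) → ≤-trans z+s≤as+i (≤-trans as+i≤j j≤w))
                                         (progression-within s j b))
             (progression-within s i a))
  rolled = rolled-stable 1≤s s≤n 1≤i i≤n window increasing
  unique = proj₁ rolled
  in-range = proj₁ (proj₂ rolled)
  stable = proj₂ (proj₂ rolled)
  length-rolled : length (map (roll n) L) ≡ k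
  length-rolled = begin
    length (map (roll n) L)                                  ≡⟨ length-map (roll n) L ⟩
    length L                                                 ≡⟨ length-++ (progression s i a) ⟩
    length (progression s i a) + length (progression s j b)  ≡⟨ cong₂ _+_ (length-applyUpTo _ a)
                                                                             (length-applyUpTo _ b) ⟩
    a + b                                                    ≡⟨ a+b≡k ⟩
    k                                                        ∎
    where open ≡-Reasoning
  rolled∈ : ∀ {x} → x ≤ n → x ∈ L → x ∈ map (roll n) L
  rolled∈ x≤n x∈L = subst (_∈ map (roll n) L) (roll-≤ x≤n) (∈-map⁺ (roll n) x∈L)

cooccur⇒splits : ∀ {n k s i m} → s ≤ n → 1 ≤ i → i + m ≤ n → 1 ≤ m →
  Cooccur n k s i (i + m) → Splits n k s m
cooccur⇒splits {n} {k} {s} {i} {m} s≤n 1≤i i+m≤n 1≤m (S , (unique , |S|≡k , in-range , stable) , i∈S , j∈S) =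
  length lower , length upper ,
  ∈-length (∈-filter⁺ (_<? j) i∈U (m<m+n i 1≤m)) ,
  ∈-length (∈-filter⁺ (¬? ∘ (_<? j)) j∈U (<-irrefl refl)) ,
  trans (length-filter+length-filter-∁ (_<? j) U) (trans (length-map (unroll n i) S) |S|≡k) ,
  subst (length lower * s ≤_) (m+n∸m≡n i m) (packing (AllPairs.filter⁺ _ apart) lower-within) ,
  m≤o∸n⇒m+n≤o (length upper * s) (m+n≤o⇒n≤o i i+m≤n)
    (subst (length upper * s ≤_) ([m+n]∸[m+o]≡n∸o i n m) (packing (AllPairs.filter⁺ _ apart) upper-within))
  where
  j = i + m
  U = map (unroll n i) S
  unrolled = unrolled-apart s≤n 1≤i (m+n≤o⇒m≤o i i+m≤n) i∈S unique in-range stable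
  apart = proj₁ unrolled
  window = proj₂ unrolled
  i∈U : i ∈ U
  i∈U = subst (_∈ U) (unroll-≥ ≤-refl) (∈-map⁺ (unroll n i) i∈S)
  j∈U : j ∈ U
  j∈U = subst (_∈ U) (unroll-≥ (m≤m+n i m)) (∈-map⁺ (unroll n i) j∈S)
  lower = filter (_<? j) U
  upper = filter (¬? ∘ (_<? j)) U
  lower-within : All (Within s i j) lower
  lower-within = All.tabulate λ y∈lower → let (y∈U , y<j) = ∈-filter⁻ (_<? j) y∈lower in
    proj₁ (All.lookup window y∈U) , below-j y<j (AllPairs-lookup swap apart y∈U j∈U (<⇒≢ y<j))
    where
    below-j : ∀ {y} → y < j → Apart s y j → y + s ≤ j
    below-j _ (inj₁ y+s≤j) = y+s≤j
    below-j y<j (inj₂ j+s≤y) = contradiction (≤-trans (m≤m+n j s) j+s≤y) (<⇒≱ y<j)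
  upper-within : All (Within s j (i + n)) upper
  upper-within = All.tabulate λ y∈upper → let (y∈U , y≮j) = ∈-filter⁻ (¬? ∘ (_<? j)) y∈upper in
    ≮⇒≥ y≮j , proj₂ (All.lookup window y∈U)

cooccur⇔splits : ∀ {n k s i m} → 1 ≤ s → s ≤ n → 1 ≤ i → i + m ≤ n → 1 ≤ m →
  Cooccur n k s i (i + m) ⇔ Splits n k s m
cooccur⇔splits 1≤s s≤n 1≤i i+m≤n 1≤m =
  mk⇔ (cooccur⇒splits s≤n 1≤i i+m≤n 1≤m) (splits⇒cooccur 1≤s s≤n 1≤i i+m≤n)

adjacent⇔¬splits-< : ∀ {n k s i j} → 1 ≤ s → s ≤ n → 1 ≤ i → j ≤ n → i < j →
  AdjG n k s i j ⇔ (i ≢ j × ¬ Splits n k s ∣ i - j ∣)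
adjacent⇔¬splits-< {n} {k} {s} {i} 1≤s s≤n 1≤i j≤n i<j with m≤n⇒∃[o]m+o≡n (<⇒≤ i<j)
... | m , refl = ⇔-id _ ×-⇔ ¬-cong-⇔ (subst (λ d → Cooccur n k s i (i + m) ⇔ Splits n k s d)
                   (sym (∣m-m+n∣≡n i m)) (cooccur⇔splits 1≤s s≤n 1≤i j≤n 1≤m))
  where
  1≤m : 1 ≤ m
  1≤m = subst (0 <_) (m+n∸m≡n i m) (m<n⇒0<n∸m i<j)

adjacent⇔¬splits : ∀ {n k s i j} → 1 ≤ s → s ≤ n → InN n i → InN n j →
  AdjG n k s i j ⇔ (i ≢ j × ¬ Splits n k s ∣ i - j ∣)
adjacent⇔¬splits {n} {k} {s} {i} {j} 1≤s s≤n (1≤i , i≤n) (1≤j , j≤n) with <-cmp i j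
... | tri< i<j _ _ = adjacent⇔¬splits-< 1≤s s≤n 1≤i j≤n i<j
... | tri≈ _ refl _ = mk⇔ (λ (i≢i , _) → contradiction refl i≢i) (λ (i≢i , _) → contradiction refl i≢i)
... | tri> _ _ j<i = (mk⇔ ≢-sym ≢-sym ×-⇔ ¬Splits-comm)
                   ⇔-∘ (adjacent⇔¬splits-< 1≤s s≤n 1≤j i≤n j<i ⇔-∘ mk⇔ AdjG-sym AdjG-sym)
  where
  AdjG-sym : ∀ {x y} → AdjG n k s x y → AdjG n k s y x
  AdjG-sym (x≢y , ¬cooccur) = ≢-sym x≢y , ¬cooccur ∘ Cooccur-sym
  ¬Splits-comm : (¬ Splits n k s ∣ j - i ∣) ⇔ (¬ Splits n k s ∣ i - j ∣)
  ¬Splits-comm = subst (λ d → (¬ Splits n k s ∣ j - i ∣) ⇔ (¬ Splits n k s d)) (∣-∣-comm j i) (⇔-id _)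

-- The splitting condition in the two ranges of n

splits⇒separated : ∀ {n k s m} → Splits n k s m → s ≤ m × s ≤ n ∸ m
splits⇒separated {s = s} {m} (a@(suc _) , b@(suc _) , _ , _ , _ , as≤m , bs+m≤n) =
  ≤-trans (m≤n*m s a) as≤m , m+n≤o⇒m≤o∸n s (≤-trans (+-monoˡ-≤ m (m≤n*m s b)) bs+m≤n)

s*[k+1]∸1≡k*s+pred-s : ∀ k s → 1 ≤ s → s * (k + 1) ∸ 1 ≡ k * s + pred s
s*[k+1]∸1≡k*s+pred-s k s 1≤s = trans (cong (_∸ 1) (s*[k+1]≡k*s+s k s)) (+-∸-assoc (k * s) 1≤s)
  where
  s*[k+1]≡k*s+s : ∀ k s → s * (k + 1) ≡ k * s + s
  s*[k+1]≡k*s+s = solve-∀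

separated⇒splits : ∀ {n k s m} .{{_ : NonZero s}} → 2 ≤ k → s * (k + 1) ∸ 1 ≤ n → m ≤ n →
  s ≤ m × s ≤ n ∸ m → Splits n k s m
separated⇒splits {n} {k} {s} {m} 2≤k s[k+1]∸1≤n m≤n (s≤m , s≤n∸m) with m / s <? k
... | yes q<k = q , k ∸ q , m≥n⇒m/n>0 s≤m , m<n⇒0<n∸m q<k , m+[n∸m]≡n (<⇒≤ q<k) , m/n*n≤m m s , (begin
    (k ∸ q) * s + m              ≡⟨ cong ((k ∸ q) * s +_) (m≡m%n+[m/n]*n m s) ⟩
    (k ∸ q) * s + (m % s + q * s) ≡⟨ regroup q (k ∸ q) (m % s) s ⟩
    (q + (k ∸ q)) * s + m % s     ≡⟨ cong (λ t → t * s + m % s) (m+[n∸m]≡n (<⇒≤ q<k)) ⟩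
    k * s + m % s                ≤⟨ +-monoʳ-≤ (k * s) (<⇒≤pred (m%n<n m s)) ⟩
    k * s + pred s               ≡⟨ s*[k+1]∸1≡k*s+pred-s k s (>-nonZero⁻¹ s) ⟨
    s * (k + 1) ∸ 1              ≤⟨ s[k+1]∸1≤n ⟩
    n                            ∎)
  where
  open ≤-Reasoning
  q = m / s
  regroup : ∀ a b ρ s → b * s + (ρ + a * s) ≡ (a + b) * s + ρ
  regroup = solve-∀
... | no q≮k = pred k , 1 , <⇒≤pred 2≤k , ≤-refl , m∸n+n≡m (<⇒≤ 2≤k) ,
  ≤-trans (*-monoˡ-≤ s (≤-trans pred[n]≤n (≮⇒≥ q≮k))) (m/n*n≤m m s) ,
  subst (λ t → t + m ≤ n) (sym (*-identityˡ s)) (m≤o∸n⇒m+n≤o s m≤n s≤n∸m)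

splits⇔separated : ∀ {n k s m} → 1 ≤ s → 2 ≤ k → s * (k + 1) ∸ 1 ≤ n → m ≤ n →
  Splits n k s m ⇔ (s ≤ m × s ≤ n ∸ m)
splits⇔separated 1≤s 2≤k s[k+1]∸1≤n m≤n =
  mk⇔ splits⇒separated (separated⇒splits {{>-nonZero 1≤s}} 2≤k s[k+1]∸1≤n m≤n)

¬separated⇔near : ∀ {n s m} → 1 ≤ s → (¬ (s ≤ m × s ≤ n ∸ m)) ⇔ m ⊓ (n ∸ m) ≤ pred s
¬separated⇔near {n} {s} {m} 1≤s = mk⇔ to from
  where
  to : ¬ (s ≤ m × s ≤ n ∸ m) → m ⊓ (n ∸ m) ≤ pred s
  to ¬sep with s ≤? m | s ≤? n ∸ m
  ... | no s≰m | _ = ≤-trans (m⊓n≤m m _) (<⇒≤pred (≰⇒> s≰m))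
  ... | yes _ | no s≰n∸m = ≤-trans (m⊓n≤n m _) (<⇒≤pred (≰⇒> s≰n∸m))
  ... | yes s≤m | yes s≤n∸m = contradiction (s≤m , s≤n∸m) ¬sep
  from : m ⊓ (n ∸ m) ≤ pred s → ¬ (s ≤ m × s ≤ n ∸ m)
  from near (s≤m , s≤n∸m) =
    <-irrefl refl (m≤pred[n]⇒suc[m]≤n {{>-nonZero 1≤s}} (≤-trans (⊓-glb s≤m s≤n∸m) near))

n≡bs+[as+r] : ∀ {n k} a b s → s * k ≤ n → a + b ≡ k → n ≡ b * s + (a * s + (n ∸ s * k))
n≡bs+[as+r] {n} a b s sk≤n refl = begin
  n                                   ≡⟨ m+[n∸m]≡n sk≤n ⟨
  s * (a + b) + (n ∸ s * (a + b))     ≡⟨ regroup a b s (n ∸ s * (a + b)) ⟩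
  b * s + (a * s + (n ∸ s * (a + b))) ∎
  where
  open ≡-Reasoning
  regroup : ∀ a b s r → s * (a + b) + r ≡ b * s + (a * s + r)
  regroup = solve-∀

splits⇔forbidden : ∀ {n k s m} → s * k ≤ n → Splits n k s m ⇔ InForbidden k s (n ∸ s * k) m
splits⇔forbidden {n} {k} {s} {m} sk≤n = mk⇔ to from
  where
  r = n ∸ s * k
  to : Splits n k s m → InForbidden k s r m
  to (a , b , 1≤a , 1≤b , a+b≡k , as≤m , bs+m≤n) = a , 1≤a , a≤pred-k , as≤m ,
    +-cancelˡ-≤ (b * s) m (a * s + r) (subst (b * s + m ≤_) (n≡bs+[as+r] a b s sk≤n a+b≡k) bs+m≤n)
    where
    a≤pred-k : a ≤ pred k
    a≤pred-k = subst (λ k → a ≤ pred k) a+b≡k (<⇒≤pred (m<m+n a 1≤b))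
  from : InForbidden k s r m → Splits n k s m
  from (d , 1≤d , d≤pred-k , ds≤m , m≤ds+r) = d , k ∸ d , 1≤d , m<n⇒0<n∸m d<k , m+[n∸m]≡n (<⇒≤ d<k) , ds≤m ,
    subst ((k ∸ d) * s + m ≤_) (sym (n≡bs+[as+r] d (k ∸ d) s sk≤n (m+[n∸m]≡n (<⇒≤ d<k))))
      (+-monoʳ-≤ ((k ∸ d) * s) m≤ds+r)
    where
    d<k : d < k
    d<k = m≤pred[n]⇒suc[m]≤n {{>-nonZero (≤-trans 1≤d (≤pred⇒≤ d≤pred-k))}} d≤pred-k

theorem3 : (n s k : ℕ) → 2 ≤ k → 3 ≤ s → s * k + 1 ≤ n →
    (s * (k + 1) ∸ 1 ≤ n → Iso n (AdjG n k s) (AdjCPow n (s ∸ 1))) ×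
    (n ≤ s * (k + 1) ∸ 2 → ∀ i j → InN n i → InN n j →
      AdjG n k s i j ⇔ (i ≢ j × ¬ InForbidden k s (n ∸ s * k) ∣ j - i ∣))
theorem3 n s k 2≤k 3≤s sk+1≤n = identity-is-iso , forbidden-distances
  where
  1≤s = ≤-trans (s≤s z≤n) 3≤s
  sk≤n = m+n≤o⇒m≤o (s * k) sk+1≤n
  s≤n = ≤-trans (m≤m*n s k {{>-nonZero (≤-trans (s≤s z≤n) 2≤k)}}) sk≤n
  ∣i-j∣≤n : ∀ {i j} → InN n i → InN n j → ∣ i - j ∣ ≤ n
  ∣i-j∣≤n {i} {j} (_ , i≤n) (_ , j≤n) = ≤-trans (∣m-n∣≤m⊔n i j) (⊔-lub i≤n j≤n)
  identity-is-iso : s * (k + 1) ∸ 1 ≤ n → Iso n (AdjG n k s) (AdjCPow n (s ∸ 1))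
  identity-is-iso large = id , id , (λ _ i∈ → i∈) , (λ _ i∈ → i∈) , (λ _ _ → refl) , (λ _ _ → refl) ,
    λ i j i∈ j∈ →
      (⇔-id _ ×-⇔ (¬separated⇔near 1≤s ⇔-∘ ¬-cong-⇔ (splits⇔separated 1≤s 2≤k large (∣i-j∣≤n i∈ j∈))))
      ⇔-∘ adjacent⇔¬splits 1≤s s≤n i∈ j∈
  forbidden-distances : n ≤ s * (k + 1) ∸ 2 → ∀ i j → InN n i → InN n j →
    AdjG n k s i j ⇔ (i ≢ j × ¬ InForbidden k s (n ∸ s * k) ∣ j - i ∣)
  forbidden-distances _ i j i∈ j∈ =
    subst (λ d → AdjG n k s i j ⇔ (i ≢ j × ¬ InForbidden k s (n ∸ s * k) d)) (∣-∣-comm i j)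
      ((⇔-id _ ×-⇔ ¬-cong-⇔ (splits⇔forbidden sk≤n)) ⇔-∘ adjacent⇔¬splits 1≤s s≤n i∈ j∈)
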